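{- Let $n$ and $k$ be positive integers and let $\mathcal{Q}$ be a blue/red colored Boolean lattice of dimension $n+k$. Then $\mathcal{Q}$ contains a red copy of $Q_n$ or a blue chain of length $k+1$ (i.e. on $k+1$ elements).
   Context: A Boolean lattice of dimension $N$ is the poset of all subsets of an $N$-element set ordered by inclusion; $Q_n$ denotes the Boolean lattice of dimension $n$. A copy of a poset $P'$ in a poset $P$ is an induced subposet of $P$ isomorphic to $P'$. In a blue/red coloring each element gets color blue or red; a subposet is blue (red) if all its elements are blue (red). -}

module Defs where

open import Data.Nat using (ℕ; suc; _+_)
open import Data.Fin using (Fin; _<_)
open import Data.Fin.Subset using (Subset; _⊆_; _⊂_)
open import Data.Product using (Σ; _×_; ∃)
open import Data.Sum using (_⊎_)
open import Function.Bundles using (_⇔_)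
open import Function.Definitions using (Injective)
open import Relation.Binary.PropositionalEquality using (_≡_)

data Colour : Set where
  blue red : Colour

Colouring : ℕ → Set
Colouring N = Subset N → Colour

-- A copy of Q_n in Q_N: an induced subposet isomorphic to Q_n, i.e. an
-- order embedding f : Q_n → Q_N (injective, and A ⊆ B ⇔ f A ⊆ f B).
record CopyOf (n N : ℕ) : Set where
  field
    emb       : Subset n → Subset N
    injective : Injective _≡_ _≡_ emb
    order     : ∀ A B → (A ⊆ B) ⇔ (emb A ⊆ emb B)

HasRedCopy : ∀ {N} → Colouring N → ℕ → Set
HasRedCopy {N} c n =
  Σ (CopyOf n N) λ φ → ∀ A → c (CopyOf.emb φ A) ≡ red

-- A chain on m elements: m pairwise comparable distinct elements,
-- listed as a strictly increasing sequence x₀ ⊂ x₁ ⊂ … ⊂ x_{m-1}.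
record Chain (m N : ℕ) : Set where
  field
    elem       : Fin m → Subset N
    increasing : ∀ i j → i < j → elem i ⊂ elem j

HasBlueChain : ∀ {N} → Colouring N → ℕ → Set
HasBlueChain {N} c m =
  Σ (Chain m N) λ ch → ∀ i → c (Chain.elem ch i) ≡ blue

-- Split Q_{n+k} as Q_n × Q_k and climb the chain S₀ ⊂ S₁ ⊂ … ⊂ S_k of initial
-- segments of Q_k. Call a sequence B₀ ⊆ B₁ ⊆ … ⊆ B_{t-1} ⊆ A in Q_n a blue stair
-- of height t under A if every B_i ∪ S_i is blue. A stair of height k + 1 is a
-- blue chain on k + 1 elements. Otherwise let h(A) ≤ k be the largest height of
-- a stair under A: h is monotone, and A ∪ S_{h(A)} is red because a blue one
-- would extend the stair. Hence A ↦ A ∪ S_{h(A)} is a red copy of Q_n.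
module Submission where

open import Defs
open import Data.Nat using (ℕ; suc; _+_; _≥_; zero; _≤_; _<_; _∸_; z≤n; s≤s)
open import Data.Sum using (_⊎_; inj₁; inj₂)
open import Data.Nat.Properties
  using (≤-refl; ≤-trans; <⇒≤; <-≤-trans; ≤-reflexive; ≤-pred; n≤1+n; n≮n; +-comm; m≤n⇒m<n∨m≡n; ∸-monoʳ-≤; m∸n≤m; m∸[m∸n]≡n)
open import Data.Fin as F using (Fin; toℕ)
open import Data.Fin.Properties using (toℕ<n)
open import Data.Fin.Subset using (Subset; _⊆_; _⊂_; inside; outside; ⊤)
open import Data.Fin.Subset.Properties
  using (⊆-refl; ⊆-trans; ⊆⊤; _⊆?_; anySubset?; drop-∷-⊆; out⊆; s⊆s; out⊂; in⊂in; out⊂in)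
open import Data.Vec using ([]; _∷_; _++_; here; there)
open import Data.Vec.Properties using (++-injectiveˡ)
open import Data.Product using (∃; _×_; _,_)
open import Data.Unit using (tt) renaming (⊤ to Unit)
open import Function.Bundles using (_⇔_; mk⇔)
open import Relation.Nullary using (Dec; yes; no; ¬_; contradiction)
open import Relation.Nullary.Decidable using (_×-dec_)
open import Relation.Binary.PropositionalEquality using (_≡_; _≢_; refl; subst)

isBlue? : (x : Colour) → Dec (x ≡ blue)
isBlue? blue = yes refl
isBlue? red  = no λ ()

≢blue⇒≡red : ∀ {x} → x ≢ blue → x ≡ red
≢blue⇒≡red {blue} x≢blue = contradiction refl x≢blue
≢blue⇒≡red {red}  _      = refl

++-mono-⊆ : ∀ {n k} {A B : Subset n} {a b : Subset k} → A ⊆ B → a ⊆ b → A ++ a ⊆ B ++ b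
++-mono-⊆ {A = []}          {[]}          _   a⊆b = a⊆b
++-mono-⊆ {A = outside ∷ A} {_ ∷ B}       A⊆B a⊆b = out⊆ (++-mono-⊆ (drop-∷-⊆ A⊆B) a⊆b)
++-mono-⊆ {A = inside ∷ A}  {inside ∷ B}  A⊆B a⊆b = s⊆s (++-mono-⊆ (drop-∷-⊆ A⊆B) a⊆b)
++-mono-⊆ {A = inside ∷ A}  {outside ∷ B} A⊆B _   with A⊆B here
... | ()

++-mono-⊂ : ∀ {n k} {A B : Subset n} {a b : Subset k} → A ⊆ B → a ⊂ b → A ++ a ⊂ B ++ b
++-mono-⊂ {A = []}          {[]}          _   a⊂b = a⊂b
++-mono-⊂ {A = outside ∷ A} {_ ∷ B}       A⊆B a⊂b = out⊂ (++-mono-⊂ (drop-∷-⊆ A⊆B) a⊂b)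
++-mono-⊂ {A = inside ∷ A}  {inside ∷ B}  A⊆B a⊂b = in⊂in (++-mono-⊂ (drop-∷-⊆ A⊆B) a⊂b)
++-mono-⊂ {A = inside ∷ A}  {outside ∷ B} A⊆B _   with A⊆B here
... | ()

⊆-++⁻ˡ : ∀ {n k} {A B : Subset n} {a b : Subset k} → A ++ a ⊆ B ++ b → A ⊆ B
⊆-++⁻ˡ {A = _ ∷ _} {_ ∷ _} A⊆B here with A⊆B here
... | here = here
⊆-++⁻ˡ {A = _ ∷ _} {_ ∷ _} A⊆B (there x∈A) = there (⊆-++⁻ˡ (drop-∷-⊆ A⊆B) x∈A)

segment : (k : ℕ) → ℕ → Subset k
segment zero    _       = []
segment (suc k) zero    = outside ∷ segment k zero
segment (suc k) (suc i) = inside ∷ segment k i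

segment-mono : ∀ k {i j} → i ≤ j → segment k i ⊆ segment k j
segment-mono (suc k) {zero}  {zero}  _         = out⊆ (segment-mono k z≤n)
segment-mono (suc k) {zero}  {suc j} _         = out⊆ (segment-mono k z≤n)
segment-mono (suc k) {suc i} {suc j} (s≤s i≤j) = s⊆s (segment-mono k i≤j)

segment-strict : ∀ k {i j} → i < j → i < k → segment k i ⊂ segment k j
segment-strict (suc k) {zero}  {suc j} _         _         = out⊂in (segment-mono k z≤n)
segment-strict (suc k) {suc i} {suc j} (s≤s i<j) (s≤s i<k) = in⊂in (segment-strict k i<j i<k)

module Grid {n k : ℕ} (c : Colouring (n + k)) where

  BlueStair : ℕ → Subset n → Set
  BlueStair zero    A = Unit
  BlueStair (suc t) A = ∃ λ B → B ⊆ A × BlueStair t B × c (B ++ segment k t) ≡ blue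

  blueStair? : ∀ t A → Dec (BlueStair t A)
  blueStair? zero    A = yes tt
  blueStair? (suc t) A =
    anySubset? λ B → B ⊆? A ×-dec blueStair? t B ×-dec isBlue? (c (B ++ segment k t))

  BlueStair-weaken : ∀ t {A A′} → A ⊆ A′ → BlueStair t A → BlueStair t A′
  BlueStair-weaken zero    _    _                      = tt
  BlueStair-weaken (suc t) A⊆A′ (B , B⊆A , stair , b) = B , ⊆-trans B⊆A A⊆A′ , stair , b

  -- The d-th step of a stair counted from the top; it lies at level t ∸ suc d.
  step : ∀ t {A} → BlueStair t A → ℕ → Subset n
  step zero    {A} _                   _       = A
  step (suc t)     (B , _)             zero    = B
  step (suc t)     (_ , _ , stair , _) (suc d) = step t stair d

  step-⊆ : ∀ t {A} (stair : BlueStair t A) d → step t stair d ⊆ A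
  step-⊆ zero    _                     _       = ⊆-refl
  step-⊆ (suc t) (_ , B⊆A , _ , _)     zero    = B⊆A
  step-⊆ (suc t) (_ , B⊆A , stair , _) (suc d) = ⊆-trans (step-⊆ t stair d) B⊆A

  step-antitone : ∀ t {A} (stair : BlueStair t A) {d d′} → d ≤ d′ → step t stair d′ ⊆ step t stair d
  step-antitone zero    _                                      _ = ⊆-refl
  step-antitone (suc t) _                   {zero}  {zero}   _ = ⊆-refl
  step-antitone (suc t) (_ , _ , stair , _) {zero}  {suc d′} _ = step-⊆ t stair d′
  step-antitone (suc t) (_ , _ , stair , _) {suc d} {suc d′} (s≤s d≤d′) =
    step-antitone t stair d≤d′

  step-blue : ∀ t {A} (stair : BlueStair t A) {d} → d < t →
    c (step t stair d ++ segment k (t ∸ suc d)) ≡ blue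
  step-blue (suc t) (_ , _ , _ , b)     {zero}  _         = b
  step-blue (suc t) (_ , _ , stair , _) {suc d} (s≤s d<t) = step-blue t stair d<t

  blueChain : ∀ {A} → BlueStair (suc k) A → HasBlueChain c (k + 1)
  blueChain stair = record { elem = elem ; increasing = increasing } , allBlue
    where
    toℕ≤k : (i : Fin (k + 1)) → toℕ i ≤ k
    toℕ≤k i = ≤-pred (≤-trans (toℕ<n i) (≤-reflexive (+-comm k 1)))

    elem : Fin (k + 1) → Subset (n + k)
    elem i = step (suc k) stair (k ∸ toℕ i) ++ segment k (toℕ i)

    increasing : ∀ i j → i F.< j → elem i ⊂ elem j
    increasing i j i<j = ++-mono-⊂
      (step-antitone (suc k) stair (∸-monoʳ-≤ k (<⇒≤ i<j)))
      (segment-strict k i<j (<-≤-trans i<j (toℕ≤k j)))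

    allBlue : ∀ i → c (elem i) ≡ blue
    allBlue i = subst (λ l → c (step (suc k) stair (k ∸ toℕ i) ++ segment k l) ≡ blue)
      (m∸[m∸n]≡n (toℕ≤k i)) (step-blue (suc k) stair (s≤s (m∸n≤m k (toℕ i))))

  height : ℕ → Subset n → ℕ
  height zero    A = zero
  height (suc m) A with blueStair? (suc m) A
  ... | yes _ = suc m
  ... | no  _ = height m A

  height-≤ : ∀ m A → height m A ≤ m
  height-≤ zero    A = z≤n
  height-≤ (suc m) A with blueStair? (suc m) A
  ... | yes _ = ≤-refl
  ... | no  _ = ≤-trans (height-≤ m A) (n≤1+n m)

  height-stair : ∀ m A → BlueStair (height m A) A
  height-stair zero    A = tt
  height-stair (suc m) A with blueStair? (suc m) A
  ... | yes stair = stair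
  ... | no  _     = height-stair m A

  height-maximal : ∀ m A {t} → t ≤ m → BlueStair t A → t ≤ height m A
  height-maximal zero    A z≤n _ = z≤n
  height-maximal (suc m) A t≤1+m stair with blueStair? (suc m) A
  ... | yes _      = t≤1+m
  ... | no  ¬stair with m≤n⇒m<n∨m≡n t≤1+m
  ...   | inj₁ t<1+m = height-maximal m A (≤-pred t<1+m) stair
  ...   | inj₂ refl  = contradiction stair ¬stair

  redCopy : ¬ BlueStair (suc k) ⊤ → HasRedCopy c n
  redCopy ¬stair = record { emb = emb ; injective = injective ; order = order } , allRed
    where
    level : Subset n → ℕ
    level = height k

    emb : Subset n → Subset (n + k)
    emb A = A ++ segment k (level A)

    injective : ∀ {A B} → emb A ≡ emb B → A ≡ B
    injective {A} {B} = ++-injectiveˡ A B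

    level-mono : ∀ {A B} → A ⊆ B → level A ≤ level B
    level-mono {A} {B} A⊆B =
      height-maximal k B (height-≤ k A) (BlueStair-weaken _ A⊆B (height-stair k A))

    order : ∀ A B → (A ⊆ B) ⇔ (emb A ⊆ emb B)
    order A B = mk⇔ emb-mono (⊆-++⁻ˡ {A = A})
      where
      emb-mono : A ⊆ B → emb A ⊆ emb B
      emb-mono A⊆B = ++-mono-⊆ {A = A} A⊆B (segment-mono k (level-mono {A} {B} A⊆B))

    allRed : ∀ A → c (emb A) ≡ red
    allRed A = ≢blue⇒≡red λ b → extend (A , ⊆-refl , height-stair k A , b)
      where
      extend : ¬ BlueStair (suc (level A)) A
      extend stair with m≤n⇒m<n∨m≡n (height-≤ k A)
      ... | inj₁ level<k = n≮n _ (height-maximal k A level<k stair)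
      ... | inj₂ level≡k =
        ¬stair (BlueStair-weaken (suc k) ⊆⊤ (subst (λ l → BlueStair (suc l) A) level≡k stair))

corollary8 : ∀ (n k : ℕ) → n ≥ 1 → k ≥ 1 → (c : Colouring (n + k)) →
    HasRedCopy c n ⊎ HasBlueChain c (k + 1)
corollary8 n k _ _ c with Grid.blueStair? c (suc k) ⊤
... | yes stair  = inj₂ (Grid.blueChain c stair)
... | no  ¬stair = inj₁ (Grid.redCopy c ¬stair)
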